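{- For every real $R$ with $1<R\le 3/2$ and every $\epsilon>0$, the competitive ratio of the proportional\&non-removable online knapsack problem with a buffer of capacity $R$ is at least $\frac{1}{R-1}-\epsilon$; i.e., for every deterministic online algorithm $\mathrm{ALG}$ there is an input $I$ with $\mathrm{OPT}(I)\ge(\frac{1}{R-1}-\epsilon)\mathrm{ALG}(I)$ (with $\mathrm{OPT}(I)>0=\mathrm{ALG}(I)$ counting as infinite ratio).
   Context: Online knapsack problem with a resource buffer: there is a knapsack of capacity $1$ and a buffer of capacity $R\ge 1$. Items $e_1,\dots,e_n$ arrive one by one; each item $e$ has size $0<s(e)\le 1$ and value $v(e)\ge 0$; $s(B),v(B)$ denote sums over a set $B$. A deterministic online algorithm maintains buffer contents $B_0=\emptyset,B_1,\dots,B_n$, with $B_i$ chosen after seeing only $e_1,\dots,e_i$, $B_i\subseteq B_{i-1}\cup\{e_i\}$, $s(B_i)\le R$; in the non-removable setting additionally $B_{i-1}\subseteq B_i$. $\mathrm{ALG}(I)=\max\{v(B)\mid B\subseteq B_n,\ s(B)\le 1\}$, $\mathrm{OPT}(I)=\max\{v(B)\mid B\subseteq\{e_1,\dots,e_n\},\ s(B)\le 1\}$. "Proportional" means $v(e)=s(e)$ for every item. The competitive ratio of an algorithm is $\sup_I \mathrm{OPT}(I)/\mathrm{ALG}(I)$ (with $a/0=\infty$ for $a>0$), and the competitive ratio of the problem is the infimum of this over all deterministic online algorithms.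
   Formalization: The buffer capacity R and the parameter ε range over the rationals instead of the reals, and the item sizes of the adversarial input are taken in the rationals. -}

module Defs where

open import Data.Bool using (Bool; if_then_else_)
open import Data.List using (List; []; _∷_; _++_; [_]; map; foldr)
open import Data.List.Relation.Unary.All using (All)
open import Data.Product using (_×_)
open import Data.Rational using (ℚ; 0ℚ; 1ℚ; _+_; _-_; _*_; _≤_; _<_; _⊔_; 1/_; ≢-nonZero)
open import Data.Rational.Properties using (_≟_)
open import Relation.Nullary using (yes; no)

-- Proportional items: an item is identified with its size s (its value is v = s).
-- Sum of sizes (= sum of values) of a list of items.
total : List ℚ → ℚ
total = foldr _+_ 0ℚ

subsets : List ℚ → List (List ℚ)
subsets []       = [] ∷ []
subsets (x ∷ xs) = subsets xs ++ map (x ∷_) (subsets xs)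

-- Maximum of a list of rationals (0 for the empty list; all our candidates are ≥ 0
-- and the empty set is always a candidate).
maxList : List ℚ → ℚ
maxList = foldr _⊔_ 0ℚ

bestPacking : List ℚ → ℚ
bestPacking X = maxList (map (λ B → if isFeasible B then total B else 0ℚ) (subsets X))
  where
  open import Relation.Nullary.Decidable using (⌊_⌋)
  open import Data.Rational.Properties using (_≤?_)
  isFeasible : List ℚ → Bool
  isFeasible B = ⌊ total B ≤? 1ℚ ⌋

ValidInput : List ℚ → Set
ValidInput I = All (λ s → (0ℚ < s) × (s ≤ 1ℚ)) I

-- A deterministic online algorithm in the non-removable setting: given the
-- items seen so far (e_1 … e_{i-1}) and the current item e_i, it decides
-- whether to put e_i into the buffer (true) or to discard it forever (false).
-- (Its earlier decisions are determined by the earlier items, so this is the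
-- general deterministic non-removable algorithm.)
OnlineAlg : Set
OnlineAlg = List ℚ → ℚ → Bool

runFrom : OnlineAlg → List ℚ → List ℚ → List ℚ
runFrom A past []       = []
runFrom A past (x ∷ xs) =
  if A past x then x ∷ runFrom A (past ++ [ x ]) xs else runFrom A (past ++ [ x ]) xs

buffer : OnlineAlg → List ℚ → List ℚ
buffer A I = runFrom A [] I

-- The algorithm respects the buffer capacity R on every valid input.
-- (Since buffers only grow, this gives s(B_i) ≤ R at every step, using prefixes.)
RespectsBuffer : ℚ → OnlineAlg → Set
RespectsBuffer R A = (I : List ℚ) → ValidInput I → total (buffer A I) ≤ R

ALG : OnlineAlg → List ℚ → ℚ
ALG A I = bestPacking (buffer A I)

OPT : List ℚ → ℚ
OPT I = bestPacking I

-- 1/p, with the (irrelevant) junk value 0 at p = 0.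
recip : ℚ → ℚ
recip p with p ≟ 0ℚ
... | yes _  = 0ℚ
... | no p≢0 = (1/ p) {{≢-nonZero p≢0}}

-- The adversary offers an item of size s slightly above R - 1, then an item of
-- size 1. An algorithm that rejects the first item ends with an empty buffer
-- while OPT = s > 0. One that accepts it cannot also keep the second item,
-- since s + 1 > R, so ALG = s while OPT ≥ 1; and s can be taken so close to
-- R - 1 that 1/s ≥ 1/(R - 1) - ε. The bound R ≤ 3/2 makes s ≤ 1 possible.
module Submission where

open import Defs
open import Data.Bool using (true; false; if_then_else_)
open import Data.Empty using (⊥-elim)
open import Data.Integer using (+_)
open import Data.List using (List; []; _∷_; [_])
open import Data.List.Membership.Propositional using (_∈_)
open import Data.List.Membership.Propositional.Properties using (∈-map⁺)
open import Data.List.Relation.Unary.All using ([]; _∷_)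
open import Data.List.Relation.Unary.Any using (here; there)
open import Data.Product using (Σ; _×_; _,_)
open import Data.Rational
  using (ℚ; 0ℚ; 1ℚ; ½; _+_; _-_; -_; _*_; _/_; _⊓_; _⊔_; _≤_; _<_; nonNegative; positive; ≢-nonZero)
open import Data.Rational.Properties
open import Data.Rational.Solver using (module +-*-Solver)
open import Data.Sum using (_⊎_; inj₁; inj₂)
open import Relation.Binary.PropositionalEquality using (_≡_; refl; sym; cong; subst; module ≡-Reasoning)
open import Relation.Nullary using (yes; no; does)
open import Relation.Nullary.Decidable using (⌊_⌋; dec-true; isYes≗does)

open +-*-Solver

p<q⇒0<q-p : ∀ {p q} → p < q → 0ℚ < q - p
p<q⇒0<q-p {p} {q} p<q = subst (_< q - p) (+-inverseʳ p) (+-monoˡ-< (- p) p<q)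

p≤q⇒0≤q-p : ∀ {p q} → p ≤ q → 0ℚ ≤ q - p
p≤q⇒0≤q-p {p} {q} p≤q = subst (_≤ q - p) (+-inverseʳ p) (+-monoˡ-≤ (- p) p≤q)

0≤q⇒p≤p+q : ∀ {p q} → 0ℚ ≤ q → p ≤ p + q
0≤q⇒p≤p+q {p} {q} 0≤q = subst (_≤ p + q) (+-identityʳ p) (+-monoʳ-≤ p 0≤q)

p<q⇒p<r⇒p<q⊓r : ∀ {p q r} → p < q → p < r → p < q ⊓ r
p<q⇒p<r⇒p<q⊓r {p} {q} {r} p<q p<r with ⊓-sel q r
... | inj₁ q⊓r≡q = subst (p <_) (sym q⊓r≡q) p<q
... | inj₂ q⊓r≡r = subst (p <_) (sym q⊓r≡r) p<r

recip-inverseˡ : ∀ {p} → 0ℚ < p → recip p * p ≡ 1ℚ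
recip-inverseˡ {p} 0<p with p ≟ 0ℚ
... | yes refl = ⊥-elim (<-irrefl refl 0<p)
... | no p≢0   = *-inverseˡ p {{≢-nonZero p≢0}}

recip-nonNeg : ∀ {p} → 0ℚ < p → 0ℚ ≤ recip p
recip-nonNeg {p} 0<p with p ≟ 0ℚ
... | yes refl = ⊥-elim (<-irrefl refl 0<p)
... | no p≢0   = <⇒≤ (positive⁻¹ _ {{1/pos⇒pos p {{positive 0<p}}}})

-- With u = 1/r: (u - ε)(r + δ) = 1 - εδ - (εr - uδ), and uδ ≤ u·εr² = εr.
[u-ε]*[r+δ]≤1 : ∀ {u r ε δ} → u * r ≡ 1ℚ → 0ℚ ≤ u → 0ℚ ≤ ε → 0ℚ ≤ δ →
                δ ≤ ε * r * r → (u - ε) * (r + δ) ≤ 1ℚ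
[u-ε]*[r+δ]≤1 {u} {r} {ε} {δ} ur≡1 0≤u 0≤ε 0≤δ δ≤εrr = begin
  (u - ε) * (r + δ)                                 ≤⟨ 0≤q⇒p≤p+q 0≤slack ⟩
  (u - ε) * (r + δ) + (ε * δ + (ε * r - u * δ))     ≡⟨ rearrange ⟩
  u * r                                             ≡⟨ ur≡1 ⟩
  1ℚ                                                ∎
  where
  open ≤-Reasoning
  uδ≤εr : u * δ ≤ ε * r
  uδ≤εr = begin
    u * δ             ≤⟨ *-monoˡ-≤-nonNeg u {{nonNegative 0≤u}} δ≤εrr ⟩
    u * (ε * r * r)   ≡⟨ solve 3 (λ u r ε → u :* (ε :* r :* r) := ε :* r :* (u :* r)) refl u r ε ⟩
    ε * r * (u * r)   ≡⟨ cong (ε * r *_) ur≡1 ⟩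
    ε * r * 1ℚ        ≡⟨ *-identityʳ (ε * r) ⟩
    ε * r             ∎
  0≤slack : 0ℚ ≤ ε * δ + (ε * r - u * δ)
  0≤slack = +-mono-≤ (nonNegative⁻¹ (ε * δ) {{nonNeg*nonNeg⇒nonNeg ε {{nonNegative 0≤ε}} δ {{nonNegative 0≤δ}}}})
                     (p≤q⇒0≤q-p uδ≤εr)
  rearrange : (u - ε) * (r + δ) + (ε * δ + (ε * r - u * δ)) ≡ u * r
  rearrange = solve 4 (λ u r ε δ → (u :- ε) :* (r :+ δ) :+ (ε :* δ :+ (ε :* r :- u :* δ)) := u :* r)
                refl u r ε δ

overflowing-size : ∀ {R ε} → 1ℚ < R → R ≤ + 3 / 2 → 0ℚ < ε →
  Σ ℚ (λ s → (0ℚ < s) × (s ≤ 1ℚ) × (R < s + 1ℚ) × ((recip (R - 1ℚ) - ε) * s ≤ 1ℚ))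
overflowing-size {R} {ε} 1<R R≤3/2 0<ε = r + δ , 0<s , s≤1 , R<s+1 , ratio
  where
  r = R - 1ℚ
  0<r : 0ℚ < r
  0<r = p<q⇒0<q-p 1<R
  εrr = ε * r * r
  0<εrr : 0ℚ < εrr
  0<εrr = positive⁻¹ εrr {{pos*pos⇒pos (ε * r) {{pos*pos⇒pos ε {{positive 0<ε}} r {{positive 0<r}}}} r {{positive 0<r}}}}
  -- δ ≤ εr² keeps the ratio within ε; δ ≤ ½ keeps s ≤ 1, as r ≤ ½.
  δ = ½ ⊓ εrr
  0<δ : 0ℚ < δ
  0<δ = p<q⇒p<r⇒p<q⊓r (positive⁻¹ ½) 0<εrr
  0<s : 0ℚ < r + δ
  0<s = +-mono-< 0<r 0<δ
  s≤1 : r + δ ≤ 1ℚ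
  s≤1 = +-mono-≤ (+-monoˡ-≤ (- 1ℚ) R≤3/2) (p⊓q≤p ½ εrr)
  R<s+1 : R < r + δ + 1ℚ
  R<s+1 = subst (R <_) (solve 2 (λ R δ → R :+ δ := R :- con 1ℚ :+ δ :+ con 1ℚ) refl R δ)
                (subst (_< R + δ) (+-identityʳ R) (+-monoʳ-< R 0<δ))
  ratio : (recip r - ε) * (r + δ) ≤ 1ℚ
  ratio = [u-ε]*[r+δ]≤1 (recip-inverseˡ 0<r) (recip-nonNeg 0<r) (<⇒≤ 0<ε) (<⇒≤ 0<δ) (p⊓q≤q ½ εrr)

∈⇒≤maxList : ∀ {x xs} → x ∈ xs → x ≤ maxList xs
∈⇒≤maxList {xs = y ∷ ys} (here refl)   = p≤p⊔q y (maxList ys)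
∈⇒≤maxList {xs = y ∷ ys} (there x∈ys) = p≤q⇒p≤r⊔q y (∈⇒≤maxList x∈ys)

packingValue : List ℚ → ℚ
packingValue B = if ⌊ total B ≤? 1ℚ ⌋ then total B else 0ℚ

packingValue-feasible : ∀ {B} → total B ≤ 1ℚ → packingValue B ≡ total B
packingValue-feasible {B} fits = cong (if_then total B else 0ℚ) (begin
  ⌊ total B ≤? 1ℚ ⌋     ≡⟨ isYes≗does (total B ≤? 1ℚ) ⟩
  does (total B ≤? 1ℚ)  ≡⟨ dec-true (total B ≤? 1ℚ) fits ⟩
  true                  ∎)
  where open ≡-Reasoning

feasible⇒≤bestPacking : ∀ {B X} → B ∈ subsets X → total B ≤ 1ℚ → total B ≤ bestPacking X
feasible⇒≤bestPacking {B} {X} B∈X fits =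
  subst (_≤ bestPacking X) (packingValue-feasible {B} fits) (∈⇒≤maxList (∈-map⁺ packingValue B∈X))

bestPacking-[x] : ∀ {x} → 0ℚ ≤ x → x ≤ 1ℚ → bestPacking [ x ] ≡ x
bestPacking-[x] {x} 0≤x x≤1 = begin
  bestPacking [ x ]               ≡⟨⟩
  0ℚ ⊔ (packingValue [ x ] ⊔ 0ℚ) ≡⟨ cong (λ v → 0ℚ ⊔ (v ⊔ 0ℚ)) (packingValue-feasible {[ x ]} x+0≤1) ⟩
  0ℚ ⊔ ((x + 0ℚ) ⊔ 0ℚ)            ≡⟨ cong (λ v → 0ℚ ⊔ (v ⊔ 0ℚ)) (+-identityʳ x) ⟩
  0ℚ ⊔ (x ⊔ 0ℚ)                   ≡⟨ cong (0ℚ ⊔_) (p≥q⇒p⊔q≡p 0≤x) ⟩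
  0ℚ ⊔ x                          ≡⟨ p≤q⇒p⊔q≡q 0≤x ⟩
  x                               ∎
  where
  open ≡-Reasoning
  x+0≤1 : x + 0ℚ ≤ 1ℚ
  x+0≤1 = subst (_≤ 1ℚ) (sym (+-identityʳ x)) x≤1

1≤bestPacking-x∷1 : ∀ x → 1ℚ ≤ bestPacking (x ∷ 1ℚ ∷ [])
1≤bestPacking-x∷1 x = subst (_≤ bestPacking (x ∷ 1ℚ ∷ [])) (+-identityʳ 1ℚ)
  (feasible⇒≤bestPacking {[ 1ℚ ]} {x ∷ 1ℚ ∷ []} (there (here refl)) (≤-reflexive (+-identityʳ 1ℚ)))

valid-x∷1 : ∀ {x} → 0ℚ < x → x ≤ 1ℚ → ValidInput (x ∷ 1ℚ ∷ [])
valid-x∷1 0<x x≤1 = (0<x , x≤1) ∷ (positive⁻¹ 1ℚ , ≤-refl) ∷ []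

keeps-nothing-or-only-first : ∀ {R x} (A : OnlineAlg) → RespectsBuffer R A →
  0ℚ < x → x ≤ 1ℚ → R < x + 1ℚ →
  buffer A [ x ] ≡ [] ⊎ buffer A (x ∷ 1ℚ ∷ []) ≡ [ x ]
keeps-nothing-or-only-first {x = x} A respects 0<x x≤1 R<x+1
  with A [] x | A [ x ] 1ℚ | respects (x ∷ 1ℚ ∷ []) (valid-x∷1 0<x x≤1)
... | false | _     | _     = inj₁ refl
... | true  | false | _     = inj₂ refl
... | true  | true  | x+1≤R = ⊥-elim (<-irrefl refl (<-≤-trans R<x+1 x+1≤R))

two-item-adversary : ∀ {R s c} (A : OnlineAlg) → RespectsBuffer R A →
  0ℚ < s → s ≤ 1ℚ → R < s + 1ℚ → c * s ≤ 1ℚ →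
  Σ (List ℚ) (λ I → ValidInput I × (0ℚ < OPT I) × (c * ALG A I ≤ OPT I))
two-item-adversary {s = s} {c} A respects 0<s s≤1 R<s+1 cs≤1
  with keeps-nothing-or-only-first A respects 0<s s≤1 R<s+1
... | inj₁ rejected =
  [ s ] , (0<s , s≤1) ∷ [] , subst (0ℚ <_) (sym packing[s]) 0<s , (begin
  c * bestPacking (buffer A [ s ])  ≡⟨ cong (λ B → c * bestPacking B) rejected ⟩
  c * 0ℚ                            ≡⟨ *-zeroʳ c ⟩
  0ℚ                                ≤⟨ <⇒≤ 0<s ⟩
  s                                 ≡⟨ packing[s] ⟨
  bestPacking [ s ]                 ∎)
  where
  open ≤-Reasoning
  packing[s] : bestPacking [ s ] ≡ s
  packing[s] = bestPacking-[x] (<⇒≤ 0<s) s≤1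
... | inj₂ keptAlone =
  s ∷ 1ℚ ∷ [] , valid-x∷1 0<s s≤1 , <-≤-trans (positive⁻¹ 1ℚ) (1≤bestPacking-x∷1 s) , (begin
  c * bestPacking (buffer A (s ∷ 1ℚ ∷ []))  ≡⟨ cong (λ B → c * bestPacking B) keptAlone ⟩
  -- {s} is given explicitly: inferring it would unify two unfolded bestPacking terms, which is very slow.
  c * bestPacking [ s ]                     ≡⟨ cong (c *_) (bestPacking-[x] {s} (<⇒≤ 0<s) s≤1) ⟩
  c * s                                     ≤⟨ cs≤1 ⟩
  1ℚ                                        ≤⟨ 1≤bestPacking-x∷1 s ⟩
  bestPacking (s ∷ 1ℚ ∷ [])                 ∎)
  where open ≤-Reasoning

theorem2 : (R : ℚ) → 1ℚ < R → R ≤ + 3 / 2 →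
    (ε : ℚ) → 0ℚ < ε →
    (A : OnlineAlg) → RespectsBuffer R A →
    Σ (List ℚ) (λ I → ValidInput I × (0ℚ < OPT I) ×
    ((recip (R - 1ℚ) - ε) * ALG A I ≤ OPT I))
theorem2 R 1<R R≤3/2 ε 0<ε A respects =
  let s , 0<s , s≤1 , R<s+1 , cs≤1 = overflowing-size 1<R R≤3/2 0<ε
  in  two-item-adversary {c = recip (R - 1ℚ) - ε} A respects 0<s s≤1 R<s+1 cs≤1
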